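{- Let $(\Sigma,S,T)$ be an automata network, $s$ a global state, $g\in\Sigma$ and $g_\top\in S(g)$ with $s(g)\neq g_\top$, and let $\mathrm{valid}_s$ be any predicate on objectives satisfying the over-approximation property below. Let $\mathcal B$ and $\mathrm{tr}(\mathcal B)$ be defined as below. Then for every trace $\pi$ from $s$ that is minimal with respect to $g_\top$ reachability from $s$, every transition occurring in $\pi$ belongs to $\mathrm{tr}(\mathcal B)$, i.e. $\bigcup_{n=1}^{|\pi|}\pi^n\subseteq \mathrm{tr}(\mathcal B)$.
   Context: An automata network (AN) $(\Sigma,S,T)$ consists of a finite set $\Sigma$ of automata; for each $a\in\Sigma$ a finite set $S(a)$ of local states (local states of different automata are distinct; $\mathbf{LS}=\bigcup_a S(a)$); global states are elements of $\prod_{a\in\Sigma}S(a)$, and $s(a)$ denotes the local state of $a$ in $s$; we write $a_i\in s$ iff $s(a)=a_i$ and $\ell\subseteq s$ iff every element of $\ell$ is in $s$. For each $a$, $T(a)$ is a finite set of local transitions $t=a_i\xrightarrow{\ell}a_j$ with $a_i,a_j\in S(a)$, $a_i\neq a_j$, and $\ell\subseteq \mathbf{LS}\setminus S(a)$ containing at most one local state of each automaton; $T=\bigcup_a T(a)$. For such $t$: $\mathrm{orig}(t)=a_i$, $\mathrm{dest}(t)=a_j$, $\mathrm{enab}(t)=\ell$, $\mathrm{pre}(t)=\{a_i\}\cup\ell$, $\mathrm{post}(t)=\{a_j\}\cup\ell$, and $t$ is said to belong to automaton $a$. A step $\tau$ is a (possibly empty) set of local transitions containing at most one transition of each automaton;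 $\mathrm{pre}(\tau)=\bigcup_{t\in\tau}\mathrm{pre}(t)$ and $\mathrm{post}(\tau)=\bigcup_{t\in\tau}\mathrm{post}(t)\setminus\{\mathrm{orig}(t)\mid t\in\tau\}$. If $\mathrm{pre}(\tau)\subseteq s$, then $s\cdot\tau$ is the global state with $(s\cdot\tau)(a)=a_j$ if some $a_i\xrightarrow{\ell}a_j\in\tau$ and $(s\cdot\tau)(a)=s(a)$ otherwise. A trace from $s$ is a finite sequence of steps $\pi=(\pi^1,\dots,\pi^{|\pi|})$ with $\mathrm{pre}(\pi^i)\subseteq s\cdot\pi^1\cdots\pi^{i-1}$ for all $i$. Its post-condition $\mathrm{post}(\pi)$ is the set of $a_j$ such that $a_j\in\mathrm{post}(\pi^n)$ for some $n$ and $S(a)\cap\mathrm{post}(\pi^m)=\emptyset$ for all $m>n$ (empty if $\pi$ is empty). A trace $\pi$ from $s$ reaches $g_\top$ if $g_\top\in\mathrm{post}(\pi)$. It is minimal w.r.t. $g_\top$ reachability from $s$ if it reaches $g_\top$ and there is no trace $\varpi$ from $s$ with $\varpi\neq\pi$, $|\varpi|\le|\pi|$, $g_\top\in\mathrm{post}(\varpi)$, and a strictly increasing map $\phi:\{1,\dots,|\varpi|\}\to\{1,\dots,|\pi|\}$ with $\varpi^i\subseteq\pi^{\phi(i)}$ for all $i$. An objective is a pair $(a_i,a_j)$ of local states of the same automaton $a$, written $a_i\leadsto a_j$. $\mathrm{local\text{ - }paths}(a_i\leadsto a_i)=\{\varepsilon\}$; for $i\neq j$, $\mathrm{local\text{ -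 }paths}(a_i\leadsto a_j)$ is the set of nonempty sequences $\eta$ of transitions of $T(a)$ with $\mathrm{orig}(\eta^1)=a_i$, $\mathrm{dest}(\eta^{|\eta|})=a_j$, $\mathrm{dest}(\eta^n)=\mathrm{orig}(\eta^{n+1})$ for $n<|\eta|$, and $\mathrm{dest}(\eta^n)\neq\mathrm{orig}(\eta^m)$ whenever $n>m$ (acyclic paths). $\mathrm{valid}_s$ is a predicate on objectives such that $\mathrm{valid}_s(a_i\leadsto a_j)$ holds whenever there exist a trace $\pi$ from $s$ and indices $m\le n$ with $a_i\in\mathrm{pre}(\pi^m)$ and $a_j\in\mathrm{post}(\pi^n)$. For each automaton $a$ write $a_0:=s(a)$. For an objective $P$, $\mathrm{rcsol}_s(P)=\{\eta\in\mathrm{local\text{ - }paths}(P)\mid \forall n,\ \forall b_k\in\mathrm{enab}(\eta^n),\ \mathrm{valid}_s(b_0\leadsto b_k)\}$, and $\mathrm{tr}(\mathrm{rcsol}_s(P))$ is the set of transitions occurring in some path of $\mathrm{rcsol}_s(P)$. $\mathcal B$ is the smallest set of objectives such that: (1) $g_0\leadsto g_\top\in\mathcal B$; (2) if $b_j\xrightarrow{\ell}b_k\in\mathrm{tr}(\mathcal B)$ then $a_0\leadsto a_i\in\mathcal B$ for every $a_i\in\ell$; (3) if $b_j\xrightarrow{\ell}b_k\in\mathrm{tr}(\mathcal B)$ and $b_\star\leadsto b_i\in\mathcal B$ for some $b_\star$, then $b_k\leadsto b_i\in\mathcal B$; where $\mathrm{tr}(\mathcal B)=\bigcup_{P\in\mathcal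 B}\mathrm{tr}(\mathrm{rcsol}_s(P))$. -}

module Defs where

open import Data.Nat using (ℕ; suc) renaming (_≤_ to _≤ℕ_)
open import Data.Fin using (Fin; toℕ) renaming (_<_ to _<ᶠ_; _≤_ to _≤ᶠ_)
open import Data.Fin.Subset using (Subset) renaming (_∈_ to _∈ˢ_; _⊆_ to _⊆ˢ_)
open import Data.List using (List; []; _∷_; _++_; [_]; length; lookup)
open import Data.List.Membership.Propositional using () renaming (_∈_ to _∈ˡ_)
open import Data.List.Relation.Unary.All using (All)
open import Data.Maybe using (Maybe; just; nothing)
open import Data.Product using (Σ; ∃-syntax; _×_; _,_; proj₁; proj₂)
open import Data.Sum using (_⊎_)
open import Relation.Binary.PropositionalEquality using (_≡_; _≢_)
open import Relation.Nullary using (¬_)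

-- An automata network.
--  * automata: Fin n
--  * local states of automaton a: Fin (k a)   (a local state is a pair (a , i),
--    so local states of different automata are automatically distinct)
--  * local transitions: Fin m, transition t belongs to automaton aut t,
--    goes from orig t to dest t, and its enabling condition enab t is a
--    partial global state (at most one local state per automaton).
record AN : Set where
  field
    n : ℕ
    k : Fin n → ℕ
    m : ℕ
    aut : Fin m → Fin n
    orig : (t : Fin m) → Fin (k (aut t))
    dest : (t : Fin m) → Fin (k (aut t))
    enab : Fin m → (b : Fin n) → Maybe (Fin (k b))
    orig≢dest : ∀ t → orig t ≢ dest t
    enab-own : ∀ t → enab t (aut t) ≡ nothing
    -- T is a *set* of transitions: distinct indices denote distinct transitions
    distinct : ∀ t u →
      _≡_ {A = Σ (Fin n) (λ a → Fin (k a))} (aut t , orig t) (aut u , orig u) →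
      _≡_ {A = Σ (Fin n) (λ a → Fin (k a))} (aut t , dest t) (aut u , dest u) →
      (∀ b → enab t b ≡ enab u b) → t ≡ u

module _ (N : AN) where
  open AN N

  LS : Set
  LS = Σ (Fin n) (λ a → Fin (k a))

  State : Set
  State = (a : Fin n) → Fin (k a)

  _∈st_ : LS → State → Set
  (a , i) ∈st s = s a ≡ i

  origLS : Fin m → LS
  origLS t = (aut t , orig t)

  destLS : Fin m → LS
  destLS t = (aut t , dest t)

  InEnab : LS → Fin m → Set
  InEnab (b , i) t = enab t b ≡ just i

  InPreT : LS → Fin m → Set
  InPreT x t = x ≡ origLS t ⊎ InEnab x t

  InPostT : LS → Fin m → Set
  InPostT x t = x ≡ destLS t ⊎ InEnab x t

  Step : Set
  Step = Subset m

  IsStep : Step → Set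
  IsStep τ = ∀ t u → t ∈ˢ τ → u ∈ˢ τ → aut t ≡ aut u → t ≡ u

  InPre : LS → Step → Set
  InPre x τ = ∃[ t ] (t ∈ˢ τ × InPreT x t)

  InPost : LS → Step → Set
  InPost x τ = (∃[ t ] (t ∈ˢ τ × InPostT x t)) × ¬ (∃[ t ] (t ∈ˢ τ × x ≡ origLS t))

  Enabled : Step → State → Set
  Enabled τ s = ∀ x → InPre x τ → x ∈st s

  Apply : State → Step → State → Set
  Apply s τ s' =
    (∀ t → t ∈ˢ τ → s' (aut t) ≡ dest t) ×
    (∀ a → (∀ t → t ∈ˢ τ → aut t ≢ a) → s' a ≡ s a)

  data IsTrace : State → List Step → Set where
    []   : ∀ {s} → IsTrace s []
    step : ∀ {s s' τ π} → IsStep τ → Enabled τ s → Apply s τ s' →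
           IsTrace s' π → IsTrace s (τ ∷ π)

  InPostTrace : LS → List Step → Set
  InPostTrace x π =
    ∃[ p ] (InPost x (lookup π p) ×
            (∀ q → p <ᶠ q → ∀ i → ¬ InPost (proj₁ x , i) (lookup π q)))

  StrictMono : ∀ {p q} → (Fin p → Fin q) → Set
  StrictMono φ = ∀ i j → i <ᶠ j → φ i <ᶠ φ j

  Minimal : State → (g : Fin n) → Fin (k g) → List Step → Set
  Minimal s g gtop π =
    IsTrace s π × InPostTrace (g , gtop) π ×
    ¬ (∃[ ϖ ] (IsTrace s ϖ × ϖ ≢ π × length ϖ ≤ℕ length π ×
               InPostTrace (g , gtop) ϖ ×
               ∃[ φ ] (StrictMono φ × (∀ i → lookup ϖ i ⊆ˢ lookup π (φ i)))))

  -- objectives a_i ⇝ a_j, written (a , i , j)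
  Objective : Set
  Objective = Σ (Fin n) (λ a → Fin (k a) × Fin (k a))

  OverApprox : State → (Objective → Set) → Set
  OverApprox s valid = ∀ a i j π → IsTrace s π → ∀ p q → p ≤ᶠ q →
    InPre (a , i) (lookup π p) → InPost (a , j) (lookup π q) → valid (a , i , j)

  NonemptyLocalPath : (a : Fin n) → Fin (k a) → Fin (k a) → List (Fin m) → Set
  NonemptyLocalPath a i j η =
    All (λ t → aut t ≡ a) η ×
    (∃[ t ] ∃[ η' ] (η ≡ t ∷ η' × origLS t ≡ (a , i))) ×
    (∃[ η' ] ∃[ t ] (η ≡ η' ++ [ t ] × destLS t ≡ (a , j))) ×
    (∀ p q → toℕ q ≡ suc (toℕ p) → destLS (lookup η p) ≡ origLS (lookup η q)) ×
    (∀ p q → q <ᶠ p → destLS (lookup η p) ≢ origLS (lookup η q))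

  LocalPath : (a : Fin n) → Fin (k a) → Fin (k a) → List (Fin m) → Set
  LocalPath a i j η = (i ≡ j × η ≡ []) ⊎ (i ≢ j × NonemptyLocalPath a i j η)

  RCSol : State → (Objective → Set) → Objective → List (Fin m) → Set
  RCSol s valid (a , i , j) η =
    LocalPath a i j η ×
    (∀ t → t ∈ˡ η → ∀ b bk → enab t b ≡ just bk → valid (b , s b , bk))

  module _ (s : State) (valid : Objective → Set) (g : Fin n) (gtop : Fin (k g)) where
    data InB : Objective → Set
    data InTrB : Fin m → Set

    data InB where
      base : InB (g , s g , gtop)
      enab-rule : ∀ {t b i} → InTrB t → enab t b ≡ just i → InB (b , s b , i)
      cont : ∀ {t x i} → InTrB t → InB (aut t , x , i) → InB (aut t , dest t , i)

    data InTrB where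
      intr : ∀ {P η t} → InB P → RCSol s valid P η → t ∈ˡ η → InTrB t

-- Prune the minimal trace π (states σ₀ … σ_L) against demands: a demand (a , d) asks the
-- pruned run ρ to agree with π on automaton a after d steps. A move of a at step j is kept
-- iff ρ agrees with π on a there and a is demanded again before π brings it back to σ_j(a);
-- every other move belongs to a detour that ρ skips. Closing the demands under "the
-- enabling states of a kept transition are demanded at its step", starting from (g , L),
-- turns ρ into a trace reaching g_⊤ whose steps are subsets of those of π, so by minimality
-- nothing was pruned. Each demand (a , d) yields the objective s(a) ⇝ σ_d(a) of 𝓑 (rules 1
-- and 2). By induction on j, a kept move of a at step j lies on the acyclic local path
-- formed by the kept moves of a up to its next demand d; that path solves ρ_j(a) ⇝ σ_d(a),
-- an objective of 𝓑 by rule 3 (ρ_j(a) is s(a) or the target of an earlier kept move), and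
-- its enabling conditions are valid by the over-approximation property.

module Submission where

open import Defs
open import Data.Bool as Bool using (Bool; true; false; _∨_)
open import Data.Empty using (⊥-elim)
open import Data.Fin as F using (Fin; toℕ; fromℕ<)
import Data.Fin.Properties as FinP
open import Data.Fin.Subset using (Subset; ⁅_⁆; _⊆_; _∉_; ∣_∣) renaming (_∈_ to _∈ˢ_; ⊥ to ∅)
open import Data.Fin.Subset.Properties using (_∈?_; ∉⊥; x∈⁅x⁆; x∈⁅y⁆⇒x≡y; p⊂q⇒∣p∣<∣q∣; ∣p∣≤n)
open import Data.List using (List; []; _∷_; _++_; [_]; length; lookup; applyUpTo)
import Data.List.Properties as ListP
open import Data.List.Properties using (length-applyUpTo; lookup-applyUpTo)
open import Data.List.Membership.Propositional using () renaming (_∈_ to _∈ˡ_)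
open import Data.List.Membership.Propositional.Properties using (∈-lookup)
open import Data.List.Relation.Unary.All as All using (All; []; _∷_)
open import Data.List.Relation.Unary.Any using (here; there)
import Data.Vec as Vec
import Data.Vec.Properties as VecP
open import Data.Maybe using (just; nothing)
import Data.Maybe.Properties as MaybeP
open import Data.Nat as ℕ using (ℕ; zero; suc; _+_; _∸_; _<_; _≤_; z≤n; s≤s; _<?_; _≤?_)
import Data.Nat.Properties as ℕP
open import Data.Nat.Induction using (<-rec)
open import Data.Product using (∃-syntax; _×_; _,_; proj₁; proj₂)
open import Data.Product.Properties using () renaming (≡-dec to Σ-≡-dec)
open import Data.Sum using (_⊎_; inj₁; inj₂)
open import Relation.Binary.PropositionalEquality hiding ([_])
open import Relation.Nullary using (¬_; Dec; yes; no; does; contradiction)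
open import Relation.Nullary.Decidable using (_×-dec_; _⊎-dec_; ¬?; dec-true)
open import Relation.Unary using (Decidable)
open import Relation.Binary.Definitions using (tri<; tri≈; tri>)

module Search {P : ℕ → Set} (P? : Decidable P) where

  NoneIn : ℕ → ℕ → Set
  NoneIn m n = ∀ i → m ≤ i → i < n → ¬ P i

  FirstIn : ℕ → ℕ → ℕ → Set
  FirstIn m n e = m ≤ e × e < n × P e × NoneIn m e

  LastBelow : ℕ → ℕ → Set
  LastBelow n e = e < n × P e × NoneIn (suc e) n

  first-unique : ∀ {m n e e'} → FirstIn m n e → FirstIn m n e' → e ≡ e'
  first-unique {e = e} {e'} (m≤e , _ , pe , none) (m≤e' , _ , pe' , none') with ℕP.<-cmp e e'
  ... | tri< e<e' _ _ = ⊥-elim (none' e m≤e e<e' pe)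
  ... | tri≈ _ e≡e' _ = e≡e'
  ... | tri> _ _ e'<e = ⊥-elim (none e' m≤e' e'<e pe')

  noneIn-extend : ∀ {m n} → NoneIn m n → ¬ P n → NoneIn m (suc n)
  noneIn-extend none ¬pn i m≤i i<1+n with ℕP.m<1+n⇒m<n∨m≡n i<1+n
  ... | inj₁ i<n  = none i m≤i i<n
  ... | inj₂ refl = ¬pn

  first? : ∀ m n → NoneIn m n ⊎ ∃[ e ] FirstIn m n e
  first? m zero = inj₁ λ _ _ ()
  first? m (suc n) with first? m n
  ... | inj₂ (e , m≤e , e<n , pe , none) = inj₂ (e , m≤e , ℕP.m<n⇒m<1+n e<n , pe , none)
  ... | inj₁ none with m ≤? n | P? n
  ...   | yes m≤n | yes pn = inj₂ (n , m≤n , ℕP.n<1+n n , pn , none)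
  ...   | yes _   | no ¬pn = inj₁ (noneIn-extend none ¬pn)
  ...   | no m≰n  | _ = inj₁ λ i m≤i i<1+n _ → m≰n (ℕP.≤-trans m≤i (ℕP.≤-pred i<1+n))

  last? : ∀ n → NoneIn 0 n ⊎ ∃[ e ] LastBelow n e
  last? zero = inj₁ λ _ _ ()
  last? (suc n) with P? n
  ... | yes pn =
    inj₂ (n , ℕP.n<1+n n , pn , λ i n<i i<1+n _ → ℕP.<-irrefl refl (ℕP.<-≤-trans n<i (ℕP.≤-pred i<1+n)))
  ... | no ¬pn with last? n
  ...   | inj₁ none = inj₁ (noneIn-extend none ¬pn)
  ...   | inj₂ (e , e<n , pe , none) = inj₂ (e , ℕP.m<n⇒m<1+n e<n , pe , noneIn-extend none ¬pn)

does⇒ : ∀ {P : Set} (P? : Dec P) → does P? ≡ true → P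
does⇒ (yes p) _ = p

module _ {m} {P : Fin m → Set} (P? : Decidable P) where

  decSubset : Subset m
  decSubset = Vec.tabulate λ t → does (P? t)

  ∈decSubset⇒ : ∀ {t} → t ∈ˢ decSubset → P t
  ∈decSubset⇒ {t} t∈ = does⇒ (P? t) (trans (sym (VecP.lookup∘tabulate _ t)) (VecP.[]=⇒lookup t∈))

  ⇒∈decSubset : ∀ {t} → P t → t ∈ˢ decSubset
  ⇒∈decSubset {t} pt = VecP.lookup⇒[]= t _ (trans (VecP.lookup∘tabulate _ t) (dec-true (P? t) pt))

module _ {A : Set} (F : A → A) (μ : A → ℕ) {bound : ℕ} (μ≤ : ∀ a → μ a ≤ bound) {P Q : A → Set}
         (P-F : ∀ {a} → P a → P (F a)) (progress : ∀ {a} → P a → Q a ⊎ μ a < μ (F a)) where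

  iterate-fuel : ∀ fuel {a} → bound ∸ μ a < fuel → P a → ∃[ b ] (P b × Q b)
  iterate-fuel (suc fuel) {a} gap<fuel pa with progress pa
  ... | inj₁ qa = a , pa , qa
  ... | inj₂ grows =
    iterate-fuel fuel (ℕP.<-≤-trans (ℕP.∸-monoʳ-< grows (μ≤ (F a))) (ℕP.≤-pred gap<fuel)) (P-F pa)

  iterate : ∀ {a} → P a → ∃[ b ] (P b × Q b)
  iterate {a} = iterate-fuel (suc (bound ∸ μ a)) ℕP.≤-refl

module Semantics (N : AN) where
  open AN N

  _≟ˡ_ : (x y : LS N) → Dec (x ≡ y)
  _≟ˡ_ = Σ-≡-dec F._≟_ F._≟_

  local-injective : ∀ {a} {i j : Fin (k a)} → _≡_ {A = LS N} (a , i) (a , j) → i ≡ j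
  local-injective refl = refl

  Moves : Step N → Fin n → Set
  Moves τ a = ∃[ t ] (t ∈ˢ τ × aut t ≡ a)

  moves? : ∀ τ a → Dec (Moves τ a)
  moves? τ a = FinP.any? λ t → (t ∈? τ) ×-dec (aut t F.≟ a)

  Touches : Step N → Fin n → Set
  Touches τ b = ∃[ i ] InPost N (b , i) τ

  touches? : ∀ τ b → Dec (Touches τ b)
  touches? τ b = FinP.any? λ i → inPost? (b , i)
    where
      inPostT? : ∀ x t → Dec (InPostT N x t)
      inPostT? (c , i) t = ((c , i) ≟ˡ destLS N t) ⊎-dec MaybeP.≡-dec F._≟_ (enab t c) (just i)
      inPost? : ∀ x → Dec (InPost N x τ)
      inPost? x = FinP.any? (λ t → (t ∈? τ) ×-dec inPostT? x t)
             ×-dec ¬? (FinP.any? λ t → (t ∈? τ) ×-dec (x ≟ˡ origLS N t))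

  apply : State N → Step N → State N
  apply s τ a with moves? τ a
  ... | yes (t , _ , t-moves-a) = subst (λ b → Fin (k b)) t-moves-a (dest t)
  ... | no _ = s a

  record Fires (τ : Step N) (s s' : State N) : Set where
    field
      isStep  : IsStep N τ
      enabled : Enabled N τ s
      applied : Apply N s τ s'

    orig-holds : ∀ {t} → t ∈ˢ τ → s (aut t) ≡ orig t
    orig-holds {t} t∈τ = enabled (origLS N t) (t , t∈τ , inj₁ refl)

    enab-holds : ∀ {t b i} → t ∈ˢ τ → enab t b ≡ just i → s b ≡ i
    enab-holds {t} {b} {i} t∈τ e = enabled (b , i) (t , t∈τ , inj₂ e)

    dest-holds : ∀ {t} → t ∈ˢ τ → s' (aut t) ≡ dest t
    dest-holds = proj₁ applied _

    idle : ∀ {a} → ¬ Moves τ a → s' a ≡ s a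
    idle {a} ¬moves = proj₂ applied a λ t t∈τ t-moves-a → ¬moves (t , t∈τ , t-moves-a)

    post-holds : ∀ {b i} → InPost N (b , i) τ → s' b ≡ i
    post-holds ((t , t∈τ , inj₁ refl) , _) = dest-holds t∈τ
    post-holds {b} {i} ((t , t∈τ , inj₂ e) , not-orig) with moves? τ b
    ... | no ¬moves = trans (idle ¬moves) (enab-holds t∈τ e)
    ... | yes (u , u∈τ , refl) =
      ⊥-elim (not-orig (u , u∈τ , cong (aut u ,_) (trans (sym (enab-holds t∈τ e)) (orig-holds u∈τ))))

    touched-pre : ∀ {b x} → InPost N (b , x) τ → InPre N (b , s b) τ
    touched-pre ((t , t∈τ , inj₁ refl) , _) = t , t∈τ , inj₁ (cong (aut t ,_) (orig-holds t∈τ))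
    touched-pre ((t , t∈τ , inj₂ e) , _) = t , t∈τ , inj₂ (trans e (cong just (sym (enab-holds t∈τ e))))

    untouched : ∀ {b} → ¬ Touches τ b → s' b ≡ s b
    untouched {b} ¬touches with moves? τ b
    ... | no ¬moves = idle ¬moves
    ... | yes (u , u∈τ , refl) = ⊥-elim (¬touches (dest u , (u , u∈τ , inj₁ refl) , dest-not-orig))
      where
        dest-not-orig : ¬ (∃[ v ] (v ∈ˢ τ × destLS N u ≡ origLS N v))
        dest-not-orig (v , v∈τ , e) with isStep u v u∈τ v∈τ (cong proj₁ e)
        ... | refl = orig≢dest u (sym (local-injective e))

  apply-moved : ∀ {τ s t} → IsStep N τ → t ∈ˢ τ → apply s τ (aut t) ≡ dest t
  apply-moved {τ} {t = t} τ-step t∈τ with moves? τ (aut t)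
  ... | no ¬moves = ⊥-elim (¬moves (t , t∈τ , refl))
  ... | yes (u , u∈τ , same) with τ-step u t u∈τ t∈τ same
  ...   | refl with same
  ...     | refl = refl

  apply-unmoved : ∀ {τ s a} → ¬ Moves τ a → apply s τ a ≡ s a
  apply-unmoved {τ} {a = a} ¬moves with moves? τ a
  ... | yes moves = ⊥-elim (¬moves moves)
  ... | no _ = refl

  apply-fires : ∀ {τ s} → IsStep N τ → Enabled N τ s → Fires τ s (apply s τ)
  apply-fires τ-step τ-enabled = record
    { isStep = τ-step ; enabled = τ-enabled
    ; applied = (λ _ → apply-moved τ-step) , (λ _ h → apply-unmoved λ (u , u∈τ , same) → h u u∈τ same) }

  applyUpTo-trace : ∀ len (f : ℕ → Step N) (σ : ℕ → State N) →
    (∀ {j} → j < len → Fires (f j) (σ j) (σ (suc j))) → IsTrace N (σ 0) (applyUpTo f len)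
  applyUpTo-trace zero f σ fires = []
  applyUpTo-trace (suc len) f σ fires =
    step isStep enabled applied (applyUpTo-trace len (λ j → f (suc j)) (λ j → σ (suc j)) (λ lt → fires (s≤s lt)))
    where open Fires (fires (s≤s z≤n))

  record Run : Set where
    field
      len    : ℕ
      stepAt : ℕ → Step N
      state  : ℕ → State N
      fires  : ∀ {j} → j < len → Fires (stepAt j) (state j) (state (suc j))

    steps : List (Step N)
    steps = applyUpTo stepAt len

    isTrace : IsTrace N (state 0) steps
    isTrace = applyUpTo-trace len stepAt state fires

    length-steps : length steps ≡ len
    length-steps = length-applyUpTo stepAt len

    index : ∀ {i} → i < len → Fin (length steps)
    index i<len = fromℕ< (subst (_ <_) (sym length-steps) i<len)

    toℕ-index : ∀ {i} (i<len : i < len) → toℕ (index i<len) ≡ i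
    toℕ-index i<len = FinP.toℕ-fromℕ< _

    lookup-steps : ∀ p → lookup steps p ≡ stepAt (toℕ p)
    lookup-steps = lookup-applyUpTo stepAt len

    lookup-index : ∀ {i} (i<len : i < len) → lookup steps (index i<len) ≡ stepAt i
    lookup-index i<len = trans (lookup-steps _) (cong stepAt (toℕ-index i<len))

    toℕ<len : ∀ (p : Fin (length steps)) → toℕ p < len
    toℕ<len p = subst (toℕ p <_) length-steps (FinP.toℕ<n p)

    module Touch (b : Fin n) = Search {P = λ q → Touches (stepAt q) b} (λ q → touches? (stepAt q) b)

    untouched-since : ∀ {b i p} → p < len → InPost N (b , i) (stepAt p) →
      Touch.NoneIn b (suc p) len → ∀ q → p < q → q ≤ len → state q b ≡ i
    untouched-since p<len post none (suc q) (s≤s p≤q) q<len with ℕP.m≤n⇒m<n∨m≡n p≤q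
    ... | inj₂ refl = Fires.post-holds (fires q<len) post
    ... | inj₁ p<q  = trans (Fires.untouched (fires q<len) (none q p<q q<len))
                            (untouched-since p<len post none q p<q (ℕP.<⇒≤ q<len))

    untouched-until : ∀ {b q} → Touch.NoneIn b 0 q → q ≤ len → state q b ≡ state 0 b
    untouched-until {q = zero} none _ = refl
    untouched-until {q = suc q} none q<len =
      trans (Fires.untouched (fires q<len) (none q z≤n (ℕP.n<1+n q)))
            (untouched-until (λ i _ i<q → none i z≤n (ℕP.m<n⇒m<1+n i<q)) (ℕP.<⇒≤ q<len))

    reaches⇒final : ∀ {b i} → InPostTrace N (b , i) steps → state len b ≡ i
    reaches⇒final {b} (p , post , none-after) =
      untouched-since (toℕ<len p) (subst (InPost N _) (lookup-steps p) post) none len (toℕ<len p) ℕP.≤-refl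
      where
        none : Touch.NoneIn b (suc (toℕ p)) len
        none q p<q q<len (i , post-q) =
          none-after (index q<len) (subst (toℕ p <_) (sym (toℕ-index q<len)) p<q) i
                     (subst (InPost N _) (sym (lookup-index q<len)) post-q)

    changed⇒reaches : ∀ {b} → state len b ≢ state 0 b → InPostTrace N (b , state len b) steps
    changed⇒reaches {b} changed with Touch.last? b len
    ... | inj₁ none = ⊥-elim (changed (untouched-until none ℕP.≤-refl))
    ... | inj₂ (p , p<len , (i , post) , none) =
      index p<len ,
      subst (InPost N _) (sym (lookup-index p<len))
            (subst (λ j → InPost N (b , j) (stepAt p)) (sym final) post) ,
      λ q p<q j post-q → none (toℕ q) (subst (_< toℕ q) (toℕ-index p<len) p<q) (toℕ<len q)
                              (j , subst (InPost N _) (lookup-steps q) post-q)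
      where
        final : state len b ≡ i
        final = untouched-since p<len post none len p<len ℕP.≤-refl

  stepOf : List (Step N) → ℕ → Step N
  stepOf []      _       = ∅
  stepOf (τ ∷ _) zero    = τ
  stepOf (_ ∷ π) (suc j) = stepOf π j

  ∈stepOf⇒<length : ∀ π {j t} → t ∈ˢ stepOf π j → j < length π
  ∈stepOf⇒<length []      t∈∅ = ⊥-elim (∉⊥ t∈∅)
  ∈stepOf⇒<length (_ ∷ _) {zero}  _  = s≤s z≤n
  ∈stepOf⇒<length (_ ∷ π) {suc j} t∈ = s≤s (∈stepOf⇒<length π t∈)

  stateOf : ∀ {s π} → IsTrace N s π → ℕ → State N
  stateOf {s} _                zero    = s
  stateOf {s} []               (suc _) = s
  stateOf     (step _ _ _ tr) (suc j) = stateOf tr j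

  traceRun : ∀ {s π} → IsTrace N s π → Run
  traceRun {π = π} tr = record
    { len = length π ; stepAt = stepOf π ; state = stateOf tr ; fires = fires tr }
    where
      fires : ∀ {s π} (tr : IsTrace N s π) {j} → j < length π →
              Fires (stepOf π j) (stateOf tr j) (stateOf tr (suc j))
      fires (step isStep enabled applied _) {zero} _ =
        record { isStep = isStep ; enabled = enabled ; applied = applied }
      fires (step _ _ _ tr) {suc j} (s≤s j<len) = fires tr j<len

  steps-traceRun : ∀ {s π} (tr : IsTrace N s π) → Run.steps (traceRun tr) ≡ π
  steps-traceRun {π = π} _ = go π
    where
      go : ∀ π → applyUpTo (stepOf π) (length π) ≡ π
      go []      = refl
      go (τ ∷ π) = cong (τ ∷_) (go π)

  lookup≡stepOf : ∀ π p → lookup π p ≡ stepOf π (toℕ p)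
  lookup≡stepOf (_ ∷ _) F.zero    = refl
  lookup≡stepOf (_ ∷ π) (F.suc p) = lookup≡stepOf π p

  module Prefix (r : Run) {j} (j≤len : j ≤ Run.len r) (τ : Step N)
                (τ-step : IsStep N τ) (τ-enabled : Enabled N τ (Run.state r j)) where
    open Run r

    prefixStep : ℕ → Step N
    prefixStep i with i <? j
    ... | yes _ = stepAt i
    ... | no _  = τ

    prefixState : ℕ → State N
    prefixState i with i ≤? j
    ... | yes _ = state i
    ... | no _  = apply (state j) τ

    prefixStep-< : ∀ {i} → i < j → prefixStep i ≡ stepAt i
    prefixStep-< {i} i<j with i <? j
    ... | yes _ = refl
    ... | no i≮j = ⊥-elim (i≮j i<j)

    prefixStep-last : prefixStep j ≡ τ
    prefixStep-last with j <? j
    ... | yes j<j = ⊥-elim (ℕP.<-irrefl refl j<j)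
    ... | no _ = refl

    prefixState-≤ : ∀ {i} → i ≤ j → prefixState i ≡ state i
    prefixState-≤ {i} i≤j with i ≤? j
    ... | yes _ = refl
    ... | no i≰j = ⊥-elim (i≰j i≤j)

    prefixState-last : prefixState (suc j) ≡ apply (state j) τ
    prefixState-last with suc j ≤? j
    ... | yes j<j = ⊥-elim (ℕP.<-irrefl refl j<j)
    ... | no _ = refl

    prefixFires : ∀ {i} → i < suc j → Fires (prefixStep i) (prefixState i) (prefixState (suc i))
    prefixFires {i} i<1+j with ℕP.m<1+n⇒m<n∨m≡n i<1+j
    ... | inj₁ i<j rewrite prefixStep-< i<j | prefixState-≤ (ℕP.<⇒≤ i<j) | prefixState-≤ i<j =
      fires (ℕP.<-≤-trans i<j j≤len)
    ... | inj₂ refl rewrite prefixStep-last | prefixState-≤ (ℕP.≤-refl {i}) | prefixState-last =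
      apply-fires τ-step τ-enabled

    prefixRun : Run
    prefixRun = record { len = suc j ; stepAt = prefixStep ; state = prefixState ; fires = prefixFires }

  -- Cut the run after j steps and fire t alone: b_k is then a post-state of the last step
  -- (t does not move b), and b_0 a pre-state of the first step touching b (of the last
  -- step if there is none).
  module EnablingValidity (r : Run) {valid : Objective N → Set} (approx : OverApprox N (Run.state r 0) valid)
                   {j t b bk} (j<len : j < Run.len r) (t∈ : t ∈ˢ Run.stepAt r j) (e : enab t b ≡ just bk) where
    open Run r

    singleton-step : IsStep N ⁅ t ⁆
    singleton-step u v u∈ v∈ _ = trans (x∈⁅y⁆⇒x≡y t u∈) (sym (x∈⁅y⁆⇒x≡y t v∈))

    singleton-enabled : Enabled N ⁅ t ⁆ (state j)
    singleton-enabled x (u , u∈ , pre) with x∈⁅y⁆⇒x≡y t u∈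
    ... | refl = Fires.enabled (fires j<len) x (t , t∈ , pre)

    open Prefix r {j} (ℕP.<⇒≤ j<len) ⁅ t ⁆ singleton-step singleton-enabled

    trace : IsTrace N (state 0) (Run.steps prefixRun)
    trace = subst (λ s → IsTrace N s (Run.steps prefixRun)) (prefixState-≤ {0} z≤n) (Run.isTrace prefixRun)

    last : Fin (length (Run.steps prefixRun))
    last = Run.index prefixRun (ℕP.n<1+n j)

    post : InPost N (b , bk) (lookup (Run.steps prefixRun) last)
    post = subst (InPost N _) (sym (trans (Run.lookup-index prefixRun (ℕP.n<1+n j)) prefixStep-last))
                 ((t , x∈⁅x⁆ t , inj₂ e) , not-orig)
      where
        not-orig : ¬ (∃[ u ] (u ∈ˢ ⁅ t ⁆ × (b , bk) ≡ origLS N u))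
        not-orig (u , u∈ , same) with x∈⁅y⁆⇒x≡y t u∈ | cong proj₁ same
        ... | refl | refl with trans (sym e) (enab-own t)
        ... | ()

    valid-enab : valid (b , state 0 b , bk)
    valid-enab with Touch.first? b 0 j
    ... | inj₁ none = approx b (state 0 b) bk (Run.steps prefixRun) trace last last ℕP.≤-refl pre post
      where
        s₀b≡bk : state 0 b ≡ bk
        s₀b≡bk = trans (sym (untouched-until none (ℕP.<⇒≤ j<len))) (Fires.enab-holds (fires j<len) t∈ e)
        pre : InPre N (b , state 0 b) (lookup (Run.steps prefixRun) last)
        pre = subst (InPre N _) (sym (trans (Run.lookup-index prefixRun (ℕP.n<1+n j)) prefixStep-last))
                    (t , x∈⁅x⁆ t , inj₂ (trans e (cong just (sym s₀b≡bk))))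
    ... | inj₂ (i , _ , i<j , (_ , touch) , none) =
      approx b (state 0 b) bk (Run.steps prefixRun) trace first last first≤last pre post
      where
        i<len = ℕP.<-trans i<j j<len
        i<1+j = ℕP.m<n⇒m<1+n i<j
        first = Run.index prefixRun i<1+j
        first≤last : toℕ first ≤ toℕ last
        first≤last = subst₂ _≤_ (sym (Run.toℕ-index prefixRun i<1+j))
                                (sym (Run.toℕ-index prefixRun (ℕP.n<1+n j))) (ℕP.<⇒≤ i<j)
        pre : InPre N (b , state 0 b) (lookup (Run.steps prefixRun) first)
        pre = subst₂ (λ x → InPre N (b , x)) (untouched-until none (ℕP.<⇒≤ i<len))
                     (sym (trans (Run.lookup-index prefixRun i<1+j) (prefixStep-< i<j)))
                     (Fires.touched-pre (fires i<len) touch)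

  enab-valid : ∀ (r : Run) {valid} → OverApprox N (Run.state r 0) valid →
    ∀ {j t b bk} → j < Run.len r → t ∈ˢ Run.stepAt r j → enab t b ≡ just bk →
    valid (b , Run.state r 0 b , bk)
  enab-valid r approx j<len t∈ e = EnablingValidity.valid-enab r approx j<len t∈ e

  data AcyclicPath : LS N → LS N → List (Fin m) → Set where
    []   : ∀ {x} → AcyclicPath x x []
    edge : ∀ {x y t η} → origLS N t ≡ x → All (λ u → destLS N u ≢ x) η →
           AcyclicPath (destLS N t) y η → AcyclicPath x y (t ∷ η)

  path-automaton : ∀ {x y η} → AcyclicPath x y η → All (λ t → aut t ≡ proj₁ x) η
  path-automaton []                  = []
  path-automaton (edge refl _ path) = refl ∷ path-automaton path

  path-last : ∀ {x y t η} → AcyclicPath x y (t ∷ η) →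
              ∃[ η' ] ∃[ u ] (t ∷ η ≡ η' ++ [ u ] × destLS N u ≡ y)
  path-last {t = t} {η = []}    (edge _ _ [])          = [] , t , refl , refl
  path-last {t = t} {η = _ ∷ _} (edge _ _ path@(edge _ _ _)) with path-last path
  ... | η' , u , split , u-ends = t ∷ η' , u , cong (t ∷_) split , u-ends

  path-linked : ∀ {x y η} → AcyclicPath x y η → ∀ p q → toℕ q ≡ suc (toℕ p) →
                destLS N (lookup η p) ≡ origLS N (lookup η q)
  path-linked (edge _ _ (edge t-from _ _)) F.zero (F.suc F.zero) _ = sym t-from
  path-linked (edge _ _ path) (F.suc p) (F.suc q) q≡1+p = path-linked path p q (ℕP.suc-injective q≡1+p)

  path-acyclic : ∀ {x y η} → AcyclicPath x y η → ∀ p q → q F.< p →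
                 destLS N (lookup η p) ≢ origLS N (lookup η q)
  path-acyclic (edge refl avoids _) (F.suc p) F.zero _ = All.lookup avoids (∈-lookup p)
  path-acyclic (edge _ _ path) (F.suc p) (F.suc q) (s≤s q<p) = path-acyclic path p q q<p

  acyclicPath⇒localPath : ∀ {a i j η} → AcyclicPath (a , i) (a , j) η → i ≢ j → LocalPath N a i j η
  acyclicPath⇒localPath []                         i≢j = ⊥-elim (i≢j refl)
  acyclicPath⇒localPath path@(edge {t = t} {η} t-from _ _) i≢j =
    inj₂ (i≢j , path-automaton path , (t , η , refl , t-from) , path-last path , path-linked path , path-acyclic path)

module Pruning (N : AN) {s : State N} {π : List (Step N)} (tr : IsTrace N s π) where
  open AN N
  open Semantics N
  open Run (traceRun tr) using () renaming (len to L; stepAt to π-step; state to σ; fires to π-fires)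

  π-fires-at : ∀ {j t} → t ∈ˢ π-step j → Fires (π-step j) (σ j) (σ (suc j))
  π-fires-at t∈ = π-fires (∈stepOf⇒<length π t∈)

  -- D a d ≡ true: the pruned run must agree with π on automaton a after d steps.
  Demand : Set
  Demand = Fin n → ℕ → Bool

  module Pruned (D : Demand) where

    Event : (a : Fin n) → Fin (k a) → ℕ → Set
    Event a x i = σ i a ≡ x ⊎ D a i ≡ true

    module Events a x = Search {P = Event a x} (λ i → (σ i a F.≟ x) ⊎-dec (D a i Bool.≟ true))

    DemandBeforeReturn : (a : Fin n) → Fin (k a) → ℕ → ℕ → Set
    DemandBeforeReturn a x j d = Events.FirstIn a x (suc j) (suc L) d × D a d ≡ true × σ d a ≢ x

    demandBeforeReturn? : ∀ a x j → Dec (∃[ d ] DemandBeforeReturn a x j d)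
    demandBeforeReturn? a x j with Events.first? a x (suc j) (suc L)
    ... | inj₁ none = no λ (d , (j<d , d≤L , event , _) , _) → none d j<d d≤L event
    ... | inj₂ (e , first) with D a e Bool.≟ true | σ e a F.≟ x
    ...   | yes De | no ne = yes (e , first , De , ne)
    ...   | no ¬De | _ = no λ (d , first′ , Dd , _) →
      ¬De (subst (λ i → D a i ≡ true) (Events.first-unique a x first′ first) Dd)
    ...   | _ | yes back = no λ (d , first′ , _ , ne) →
      ne (subst (λ i → σ i a ≡ x) (Events.first-unique a x first first′) back)

    returns-first : ∀ {a x j} → ¬ (∃[ d ] DemandBeforeReturn a x j d) →
      ∀ {d} → j < d → d ≤ L → D a d ≡ true → ∃[ i ] (j < i × i ≤ d × σ i a ≡ x)
    returns-first {a} {x} {j} ¬first {d} j<d d≤L Dd with Events.first? a x (suc j) (suc L)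
    ... | inj₁ none = ⊥-elim (none d j<d (s≤s d≤L) (inj₂ Dd))
    ... | inj₂ (e , j<e , e≤L , event , none) = e , j<e , e≤d , back event
      where
        e≤d : e ≤ d
        e≤d = ℕP.≮⇒≥ λ d<e → none d j<d d<e (inj₂ Dd)
        back : Event a x e → σ e a ≡ x
        back (inj₁ eq) = eq
        back (inj₂ De) with σ e a F.≟ x
        ... | yes eq = eq
        ... | no ne = ⊥-elim (¬first (e , (j<e , e≤L , inj₂ De , none) , De , ne))

    Keepable : State N → ℕ → Fin m → Set
    Keepable r j t =
      t ∈ˢ π-step j × r (aut t) ≡ σ j (aut t) × ∃[ d ] DemandBeforeReturn (aut t) (σ j (aut t)) j d

    keepable? : ∀ r j t → Dec (Keepable r j t)
    keepable? r j t =
      (t ∈? π-step j) ×-dec (r (aut t) F.≟ σ j (aut t)) ×-dec demandBeforeReturn? (aut t) (σ j (aut t)) j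

    ρ : ℕ → State N
    prunedStep : ℕ → Step N

    ρ zero    = s
    ρ (suc j) = apply (ρ j) (prunedStep j)

    prunedStep j = decSubset (keepable? (ρ j) j)

    Kept : ℕ → Fin m → Set
    Kept j = Keepable (ρ j) j

    KeptMove : ℕ → Fin n → Set
    KeptMove j a = ∃[ u ] (Kept j u × aut u ≡ a)

    keptMove? : ∀ j a → Dec (KeptMove j a)
    keptMove? j a = FinP.any? λ u → keepable? (ρ j) j u ×-dec (aut u F.≟ a)

    kept-of : ∀ {j u} → u ∈ˢ prunedStep j → Kept j u
    kept-of {j} = ∈decSubset⇒ (keepable? (ρ j) j)

    kept-unique : ∀ {j u t} → Kept j u → t ∈ˢ π-step j → aut u ≡ aut t → u ≡ t
    kept-unique (u∈ , _) t∈ = Fires.isStep (π-fires-at t∈) _ _ u∈ t∈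

    pruned-isStep : ∀ j → IsStep N (prunedStep j)
    pruned-isStep j u v u∈ v∈ = kept-unique (kept-of u∈) (proj₁ (kept-of v∈))

    ρ-moved : ∀ {j u} → Kept j u → ρ (suc j) (aut u) ≡ dest u
    ρ-moved {j} Ku = apply-moved (pruned-isStep j) (⇒∈decSubset (keepable? (ρ j) j) Ku)

    ρ-unmoved : ∀ {j a} → ¬ KeptMove j a → ρ (suc j) a ≡ ρ j a
    ρ-unmoved ¬move = apply-unmoved λ (u , u∈ , same) → ¬move (u , kept-of u∈ , same)

    revisited-after : ∀ {a d j} → d ≤ L → D a d ≡ true → j < d → ¬ KeptMove j a → ρ j a ≡ σ j a →
      ∃[ i ] (j < i × i ≤ d × σ i a ≡ σ j a)
    revisited-after {a} {j = j} d≤L Dd j<d ¬kept agree with moves? (π-step j) a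
    ... | no ¬moves = suc j , ℕP.≤-refl , j<d , Fires.idle (π-fires (ℕP.<-≤-trans j<d d≤L)) ¬moves
    ... | yes (u , u∈ , refl) = returns-first (λ first → ¬kept (u , (u∈ , agree , first) , refl)) j<d d≤L Dd

    ρ-revisited : ∀ {a d} → d ≤ L → D a d ≡ true →
                  ∀ j → j ≤ d → ∃[ i ] (j ≤ i × i ≤ d × σ i a ≡ ρ j a)
    ρ-revisited _ _ zero _ = 0 , z≤n , z≤n , refl
    ρ-revisited {a} d≤L Dd (suc j) j<d with keptMove? j a
    ... | yes (u , Ku@(u∈ , _) , refl) =
      suc j , ℕP.≤-refl , j<d , trans (Fires.dest-holds (π-fires-at u∈) u∈) (sym (ρ-moved Ku))
    ... | no ¬kept with ρ j a F.≟ σ j a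
    ...   | yes agree =
      let i , j<i , i≤d , back = revisited-after d≤L Dd j<d ¬kept agree
      in  i , j<i , i≤d , trans back (sym (trans (ρ-unmoved ¬kept) agree))
    ...   | no disagree =
      let i , j≤i , i≤d , σi = ρ-revisited d≤L Dd j (ℕP.<⇒≤ j<d)
      in  i , ℕP.≤∧≢⇒< j≤i (λ j≡i → disagree (sym (subst (λ i → σ i a ≡ ρ j a) (sym j≡i) σi))) ,
          i≤d , trans σi (sym (ρ-unmoved ¬kept))

    ρ-agrees : ∀ {a d} → d ≤ L → D a d ≡ true → ρ d a ≡ σ d a
    ρ-agrees {a} d≤L Dd with ρ-revisited d≤L Dd _ ℕP.≤-refl
    ... | i , d≤i , i≤d , σi = trans (sym σi) (cong (λ i → σ i a) (ℕP.≤-antisym i≤d d≤i))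

    ρ-origin : ∀ j a → ρ j a ≡ s a ⊎ ∃[ i ] (i < j × ∃[ u ] (Kept i u × destLS N u ≡ (a , ρ j a)))
    ρ-origin zero a = inj₁ refl
    ρ-origin (suc j) a with keptMove? j a
    ... | yes (u , Ku , refl) = inj₂ (j , ℕP.≤-refl , u , Ku , cong (aut u ,_) (sym (ρ-moved Ku)))
    ... | no ¬kept rewrite ρ-unmoved ¬kept with ρ-origin j a
    ...   | inj₁ initial = inj₁ initial
    ...   | inj₂ (i , i<j , u , Ku , enters) = inj₂ (i , ℕP.m<n⇒m<1+n i<j , u , Ku , enters)

    segment : Fin n → ℕ → ℕ → List (Fin m)
    segment a j zero    = []
    segment a j (suc r) with keptMove? j a
    ... | yes (u , _) = u ∷ segment a (suc j) r
    ... | no _        = segment a (suc j) r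

    segment-kept : ∀ a j r {u} → u ∈ˡ segment a j r → ∃[ i ] Kept i u
    segment-kept a j (suc r) u∈ with keptMove? j a
    segment-kept a j (suc r) (here refl) | yes (_ , Ku , _) = j , Ku
    segment-kept a j (suc r) (there u∈)  | yes _ = segment-kept a (suc j) r u∈
    segment-kept a j (suc r) u∈          | no _  = segment-kept a (suc j) r u∈

    segment-starts : ∀ {j t r} → 0 < r → Kept j t → t ∈ˡ segment (aut t) j r
    segment-starts {j} {t} {suc r} _ Kt with keptMove? j (aut t)
    ... | yes (u , Ku , same) = here (sym (kept-unique Ku (proj₁ Kt) same))
    ... | no ¬kept = ⊥-elim (¬kept (t , Kt , refl))

    segment-avoids : ∀ {a y e} j r → j + r ≡ e → (∀ {i} → j < i → i ≤ e → σ i a ≢ y) →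
      All (λ v → destLS N v ≢ (a , y)) (segment a j r)
    segment-avoids j zero _ _ = []
    segment-avoids {a} {e = e} j (suc r) j+r≡e avoid with keptMove? j a
    ... | yes (u , (u∈ , _) , refl) =
      (λ enters → avoid (ℕP.n<1+n j) 1+j≤e (trans (Fires.dest-holds (π-fires-at u∈) u∈) (local-injective enters)))
      ∷ rest
      where
        1+j≤e = subst (suc j ≤_) (trans (sym (ℕP.+-suc j r)) j+r≡e) (ℕP.m≤m+n (suc j) r)
        rest = segment-avoids (suc j) r (trans (sym (ℕP.+-suc j r)) j+r≡e)
                              (λ j<i → avoid (ℕP.<-trans (ℕP.n<1+n j) j<i))
    ... | no _ = segment-avoids (suc j) r (trans (sym (ℕP.+-suc j r)) j+r≡e)
                                (λ j<i → avoid (ℕP.<-trans (ℕP.n<1+n j) j<i))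

    NoReturn : Fin n → ℕ → ℕ → Set
    NoReturn a j₀ e = ∀ {i u} → j₀ ≤ i → i < e → Kept i u → aut u ≡ a →
                      ∀ {i′} → i < i′ → i′ ≤ e → σ i′ a ≢ σ i a

    -- The kept moves of a between j and its next demand d all have d as next demand, so
    -- none of their origins is revisited before d.
    no-return : ∀ {a x j d} → DemandBeforeReturn a x j d → NoReturn a j d
    no-return {d = d} ((_ , _ , _ , none) , Dd , _) {i} j≤i i<d
              (_ , _ , d′ , (i<d′ , _ , _ , none′) , Dd′ , ne) refl {i′} i<i′ i′≤d with ℕP.<-cmp d′ d
    ... | tri< d′<d _ _ = ⊥-elim (none d′ (ℕP.≤-trans (s≤s j≤i) i<d′) d′<d (inj₂ Dd′))
    ... | tri> _ _ d<d′ = ⊥-elim (none′ d i<d d<d′ (inj₂ Dd))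
    ... | tri≈ _ refl _ with ℕP.m≤n⇒m<n∨m≡n i′≤d
    ...   | inj₁ i′<d = λ back → none′ i′ i<i′ i′<d (inj₁ back)
    ...   | inj₂ refl = ne

    segment-path : ∀ {a j₀ e} → NoReturn a j₀ e → ∀ j r → j₀ ≤ j → j + r ≡ e →
      AcyclicPath (a , ρ j a) (a , ρ e a) (segment a j r)
    segment-path {a} no-ret j zero _ j+0≡e =
      subst (λ i → AcyclicPath (a , ρ j a) (a , ρ i a) []) (trans (sym (ℕP.+-identityʳ j)) j+0≡e) []
    segment-path {a} {e = e} no-ret j (suc r) j₀≤j j+r≡e with keptMove? j a
    ... | yes (u , Ku@(u∈ , agree , _) , refl) =
      edge (cong (aut u ,_) (sym (trans agree (Fires.orig-holds (π-fires-at u∈) u∈))))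
           (segment-avoids (suc j) r 1+j+r≡e
              λ j<i i≤e back → no-ret j₀≤j j<e Ku refl (ℕP.<-trans (ℕP.n<1+n j) j<i) i≤e (trans back agree))
           (subst (λ x → AcyclicPath (aut u , x) (aut u , ρ e (aut u)) (segment (aut u) (suc j) r)) (ρ-moved Ku)
              (segment-path no-ret (suc j) r (ℕP.m≤n⇒m≤1+n j₀≤j) 1+j+r≡e))
      where
        1+j+r≡e = trans (sym (ℕP.+-suc j r)) j+r≡e
        j<e = subst (j <_) 1+j+r≡e (s≤s (ℕP.m≤m+n j r))
    ... | no ¬kept =
      subst (λ x → AcyclicPath (a , x) (a , ρ e a) (segment a (suc j) r)) (ρ-unmoved ¬kept)
            (segment-path no-ret (suc j) r (ℕP.m≤n⇒m≤1+n j₀≤j) (trans (sym (ℕP.+-suc j r)) j+r≡e))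

  module Relevance {valid : Objective N → Set} (approx : OverApprox N s valid) (g : Fin n) (gtop : Fin (k g)) where

    𝓑 : Objective N → Set
    𝓑 = InB N s valid g gtop

    tr𝓑 : Fin m → Set
    tr𝓑 = InTrB N s valid g gtop

    Sound : Demand → Set
    Sound D = ∀ {a d} → D a d ≡ true → d ≤ L × 𝓑 (a , s a , σ d a)

    cont-at : ∀ {t a x z y} → tr𝓑 t → destLS N t ≡ (a , x) → 𝓑 (a , z , y) → 𝓑 (a , x , y)
    cont-at t∈B refl = cont t∈B

    module _ {D : Demand} (sound : Sound D) where
      open Pruned D

      kept⇒tr𝓑-step : ∀ {j t} → (∀ {i} → i < j → ∀ {u} → Kept i u → tr𝓑 u) →
        Kept j t → tr𝓑 t
      kept⇒tr𝓑-step {j} {t} earlier Kt@(_ , agree , d , first@((j<d , d<1+L , _) , Dd , ne)) =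
        intr objective (acyclicPath⇒localPath path differ , enabling-valid) (segment-starts (ℕP.m<n⇒0<n∸m j<d) Kt)
        where
          a = aut t
          d≤L = ℕP.≤-pred d<1+L
          path : AcyclicPath (a , ρ j a) (a , ρ d a) (segment a j (d ∸ j))
          path = segment-path (no-return first) j (d ∸ j) ℕP.≤-refl (ℕP.m+[n∸m]≡n (ℕP.<⇒≤ j<d))
          differ : ρ j a ≢ ρ d a
          differ same = ne (trans (sym (ρ-agrees d≤L Dd)) (trans (sym same) agree))
          enabling-valid : ∀ u → u ∈ˡ segment a j (d ∸ j) →
                           ∀ b bk → enab u b ≡ just bk → valid (b , s b , bk)
          enabling-valid u u∈ b bk e with segment-kept a j (d ∸ j) u∈
          ... | i , (u∈π , _) = enab-valid (traceRun tr) approx (∈stepOf⇒<length π u∈π) u∈π e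
          demanded : 𝓑 (a , s a , ρ d a)
          demanded = subst (λ x → 𝓑 (a , s a , x)) (sym (ρ-agrees d≤L Dd)) (proj₂ (sound Dd))
          objective : 𝓑 (a , ρ j a , ρ d a)
          objective with ρ-origin j a
          ... | inj₁ initial = subst (λ x → 𝓑 (a , x , ρ d a)) (sym initial) demanded
          ... | inj₂ (i , i<j , u , Ku , enters) = cont-at (earlier i<j Ku) enters demanded

      kept⇒tr𝓑 : ∀ j {t} → Kept j t → tr𝓑 t
      kept⇒tr𝓑 = <-rec (λ j → ∀ {t} → Kept j t → tr𝓑 t) λ j earlier → kept⇒tr𝓑-step earlier

    NewDemand : Demand → Fin n → ℕ → Set
    NewDemand D b j = ∃[ t ] (Pruned.Kept D j t × ∃[ bk ] enab t b ≡ just bk)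

    newDemand? : ∀ D b j → Dec (NewDemand D b j)
    newDemand? D b j = FinP.any? λ t → Pruned.keepable? D (Pruned.ρ D j) j t ×-dec reads? t
      where
        reads? : ∀ t → Dec (∃[ bk ] enab t b ≡ just bk)
        reads? t with enab t b
        ... | just bk = yes (bk , refl)
        ... | nothing = no λ { (_ , ()) }

    addDemands : Demand → Demand
    addDemands D b j = D b j ∨ does (newDemand? D b j)

    addDemands-⊇ : ∀ {D b j} → D b j ≡ true → addDemands D b j ≡ true
    addDemands-⊇ Dbj rewrite Dbj = refl

    Closed : Demand → Set
    Closed D = ∀ {j t b bk} → Pruned.Kept D j t → enab t b ≡ just bk → D b j ≡ true

    sound-addDemands : ∀ {D} → Sound D → Sound (addDemands D)
    sound-addDemands {D} sound {a} {d} added with D a d in Dad | newDemand? D a d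
    ... | true  | _ = sound Dad
    ... | false | yes (t , Kt@(t∈ , _) , bk , e) =
      ℕP.<⇒≤ (∈stepOf⇒<length π t∈) ,
      subst (λ x → 𝓑 (a , s a , x)) (sym (Fires.enab-holds (π-fires-at t∈) t∈ e))
            (enab-rule (kept⇒tr𝓑 sound d Kt) e)

    -- Demands at times ≤ L, as a subset of Fin n × Fin (suc L): its size bounds the closure.
    atSlot : Demand → Fin (n ℕ.* suc L) → Bool
    atSlot D x = D (proj₁ (F.remQuot {n} (suc L) x)) (toℕ (proj₂ (F.remQuot {n} (suc L) x)))

    slot? : ∀ D x → Dec (atSlot D x ≡ true)
    slot? D x = atSlot D x Bool.≟ true

    demandSet : Demand → Subset (n ℕ.* suc L)
    demandSet D = decSubset (slot? D)

    closed-or-grows : ∀ D → Closed D ⊎ ∣ demandSet D ∣ < ∣ demandSet (addDemands D) ∣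
    closed-or-grows D with FinP.any? (λ b → FinP.any? λ (j : Fin L) →
                             newDemand? D b (toℕ j) ×-dec (D b (toℕ j) Bool.≟ false))
    ... | yes (b , j , new , Dbj) = inj₂ (p⊂q⇒∣p∣<∣q∣ (grows , slot , slot-added , slot-new))
      where
        slot = F.combine b (F.inject₁ j)
        at-slot : ∀ D′ → atSlot D′ slot ≡ D′ b (toℕ j)
        at-slot D′ = trans (cong (λ (c , i) → D′ c (toℕ i)) (FinP.remQuot-combine b (F.inject₁ j)))
                           (cong (D′ b) (FinP.toℕ-inject₁ j))
        grows : ∀ {x} → x ∈ˢ demandSet D → x ∈ˢ demandSet (addDemands D)
        grows x∈ = ⇒∈decSubset (slot? (addDemands D)) (addDemands-⊇ (∈decSubset⇒ (slot? D) x∈))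
        slot-added : slot ∈ˢ demandSet (addDemands D)
        slot-added = ⇒∈decSubset (slot? (addDemands D)) (trans (at-slot (addDemands D))
                       (subst (λ x → x ∨ does (newDemand? D b (toℕ j)) ≡ true) (sym Dbj)
                              (dec-true (newDemand? D b (toℕ j)) new)))
        slot-new : slot ∉ demandSet D
        slot-new slot∈ = contradiction (trans (sym Dbj) (trans (sym (at-slot D)) (∈decSubset⇒ (slot? D) slot∈))) λ ()
    ... | no none = inj₁ closed
      where
        closed : Closed D
        closed {j} {t} {b} {bk} Kt@(t∈ , _) e with D b j in Dbj
        ... | true = refl
        ... | false = ⊥-elim (none (b , fromℕ< j<L , subst (λ i → NewDemand D b i × D b i ≡ false)
                                                           (sym (FinP.toℕ-fromℕ< j<L)) ((t , Kt , bk , e) , Dbj)))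
          where j<L = ∈stepOf⇒<length π t∈

    prunedRun : ∀ {D} → Closed D → Run
    prunedRun {D} closed = record
      { len = L ; stepAt = prunedStep ; state = ρ ; fires = λ {j} _ → apply-fires (pruned-isStep j) (enabled j) }
      where
        open Pruned D
        enabled : ∀ j → Enabled N (prunedStep j) (ρ j)
        enabled j _ (u , u∈ , inj₁ refl) with kept-of u∈
        ... | u∈π , agree , _ = trans agree (Fires.orig-holds (π-fires-at u∈π) u∈π)
        enabled j (b , bk) (u , u∈ , inj₂ e) with kept-of u∈
        ... | Ku@(u∈π , _) =
          trans (ρ-agrees (ℕP.<⇒≤ (∈stepOf⇒<length π u∈π)) (closed Ku e))
                (Fires.enab-holds (π-fires-at u∈π) u∈π e)

    initialDemand : Demand
    initialDemand b j = does ((b F.≟ g) ×-dec (j ℕ.≟ L))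

    closedDemand : σ L g ≡ gtop → ∃[ D ] ((Sound D × D g L ≡ true) × Closed D)
    closedDemand final =
      iterate addDemands (λ D → ∣ demandSet D ∣) (λ D → ∣p∣≤n (demandSet D))
              {P = λ D → Sound D × D g L ≡ true} {Q = Closed}
              (λ (sound , goal) → sound-addDemands sound , addDemands-⊇ goal) (λ {D} _ → closed-or-grows D)
              ((λ {a} {d} → initial-sound {a} {d}) , initial-goal)
      where
        initial-sound : Sound initialDemand
        initial-sound {a} {d} h with does⇒ ((a F.≟ g) ×-dec (d ℕ.≟ L)) h
        ... | refl , refl = ℕP.≤-refl , subst (λ x → 𝓑 (g , s g , x)) (sym final) base
        initial-goal : initialDemand g L ≡ true
        initial-goal = dec-true ((g F.≟ g) ×-dec (L ℕ.≟ L)) (refl , refl)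

    σ-final : InPostTrace N (g , gtop) π → σ L g ≡ gtop
    σ-final reaches = Run.reaches⇒final (traceRun tr) (subst (InPostTrace N _) (sym (steps-traceRun tr)) reaches)

    pruned≡π : s g ≢ gtop → Minimal N s g gtop π → ∀ {D} → D g L ≡ true → (closed : Closed D) →
      Run.steps (prunedRun closed) ≡ π
    pruned≡π sg≢gtop (_ , reaches , no-smaller) {D} goal closed
      with ListP.≡-dec (VecP.≡-dec Bool._≟_) (Run.steps (prunedRun closed)) π
    ... | yes same = same
    ... | no differ = ⊥-elim (no-smaller (Run.steps ϖ , Run.isTrace ϖ , differ , ℕP.≤-reflexive (Run.length-steps ϖ) ,
                                         ϖ-reaches , φ , φ-mono , ϖ⊆π))
      where
        open Pruned D
        ϖ = prunedRun closed
        ρ-final : ρ L g ≡ gtop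
        ρ-final = trans (ρ-agrees ℕP.≤-refl goal) (σ-final reaches)
        ϖ-reaches : InPostTrace N (g , gtop) (Run.steps ϖ)
        ϖ-reaches = subst (λ x → InPostTrace N (g , x) (Run.steps ϖ)) ρ-final
                          (Run.changed⇒reaches ϖ λ same → sg≢gtop (trans (sym same) ρ-final))
        φ : Fin (length (Run.steps ϖ)) → Fin (length π)
        φ = F.cast (Run.length-steps ϖ)
        φ-mono : StrictMono N φ
        φ-mono i j i<j = subst₂ _<_ (sym (FinP.toℕ-cast _ i)) (sym (FinP.toℕ-cast _ j)) i<j
        ϖ⊆π : ∀ i → lookup (Run.steps ϖ) i ⊆ lookup π (φ i)
        ϖ⊆π i {u} u∈ = subst (u ∈ˢ_) (sym (trans (lookup≡stepOf π (φ i)) (cong (stepOf π) (FinP.toℕ-cast _ i))))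
                             (proj₁ (kept-of (subst (u ∈ˢ_) (Run.lookup-steps ϖ i) u∈)))

    minimal⇒tr𝓑 : s g ≢ gtop → Minimal N s g gtop π → ∀ p {t} → t ∈ˢ lookup π p → tr𝓑 t
    minimal⇒tr𝓑 sg≢gtop minimal@(_ , reaches , _) p {t} with closedDemand (σ-final reaches)
    ... | D , (sound , goal) , closed =
      subst (λ xs → ∀ p → t ∈ˢ lookup xs p → tr𝓑 t) (pruned≡π sg≢gtop minimal goal closed) pruned⊆tr𝓑 p
      where
        open Pruned D
        pruned⊆tr𝓑 : ∀ p → t ∈ˢ lookup (Run.steps (prunedRun closed)) p → tr𝓑 t
        pruned⊆tr𝓑 p t∈ =
          kept⇒tr𝓑 sound (toℕ p) (kept-of (subst (t ∈ˢ_) (Run.lookup-steps (prunedRun closed) p) t∈))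

theorem1 : (N : AN) (s : State N) (g : Fin (AN.n N)) (gtop : Fin (AN.k N g)) →
    s g ≢ gtop →
    (valid : Objective N → Set) → OverApprox N s valid →
    (π : List (Step N)) → Minimal N s g gtop π →
    (p : Fin (length π)) (t : Fin (AN.m N)) → t ∈ˢ lookup π p →
    InTrB N s valid g gtop t
theorem1 N s g gtop sg≢gtop valid approx π minimal@(tr , _) p t =
  Pruning.Relevance.minimal⇒tr𝓑 N tr approx g gtop sg≢gtop minimal p
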